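{- Let $\mathbf L=(L,\vee,\wedge,0,1)$ be a bounded lattice, $a,b\in L$ with $a\leq b$, $x\in[a,b]$, and let $y$ be a complement of $x$ (i.e. $x\vee y=1$, $x\wedge y=0$). Assume that $(a,y,b)$ is a modular triple and put $e:=(a\vee y)\wedge b=a\vee(y\wedge b)$. Then the following are equivalent: (i) $e\in R(a,b,x)$; (ii) $(a,y\wedge b,x)$ and $(x,a\vee y,b)$ are modular triples.
   Context: For a lattice and elements $a\leq b$, $x\in[a,b]$, an element $z\in[a,b]$ is a relative complement of $x$ in $[a,b]$ if $x\vee z=b$ and $x\wedge z=a$; $R(a,b,x)$ denotes the set of all such relative complements. A triple $(p,q,r)$ of elements of a lattice is called modular if $p\leq r$ and $(p\vee q)\wedge r=p\vee(q\wedge r)$. -}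

module Defs where

open import Level using (Level)
open import Data.Product using (_×_)
open import Relation.Binary.Lattice using (BoundedLattice)

module _ {c ℓ₁ ℓ₂ : Level} (L : BoundedLattice c ℓ₁ ℓ₂) where
  open BoundedLattice L

  InInterval : Carrier → Carrier → Carrier → Set ℓ₂
  InInterval a b x = (a ≤ x) × (x ≤ b)

  IsComplement : Carrier → Carrier → Set ℓ₁
  IsComplement x y = ((x ∨ y) ≈ ⊤) × ((x ∧ y) ≈ ⊥)

  InR : Carrier → Carrier → Carrier → Carrier → Set (ℓ₁ Level.⊔ ℓ₂)
  InR a b x z = InInterval a b z × ((x ∨ z) ≈ b) × ((x ∧ z) ≈ a)

  ModularTriple : Carrier → Carrier → Carrier → Set (ℓ₁ Level.⊔ ℓ₂)
  ModularTriple p q r = (p ≤ r) × (((p ∨ q) ∧ r) ≈ (p ∨ (q ∧ r)))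

{-# OPTIONS --safe #-}
module Submission where

-- The modular law for (a, y, b) lets e be read in both shapes. Since x ∧ y = 0, the
-- element (y ∧ b) ∧ x lies below a, so the triple (a, y ∧ b, x) is modular exactly
-- when x ∧ e = a; since x ∨ y = 1, b lies below x ∨ (a ∨ y), so the triple
-- (x, a ∨ y, b) is modular exactly when x ∨ e = b. As e always lies in [a, b], the
-- two conditions together say precisely that e is a relative complement of x.

open import Defs
open import Level using (Level)
open import Data.Product using (_×_; _,_)
open import Function.Bundles using (_⇔_; mk⇔; Equivalence)
open import Relation.Binary.Lattice using (BoundedLattice)
import Relation.Binary.Lattice.Properties.MeetSemilattice as MeetSemilatticeProperties

module _ {c ℓ₁ ℓ₂ : Level} (L : BoundedLattice c ℓ₁ ℓ₂) where
  open BoundedLattice L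

  modularTriple⇔[p∨q]∧r≈p : ∀ {p q r} → p ≤ r → q ∧ r ≤ p →
    ModularTriple L p q r ⇔ ((p ∨ q) ∧ r ≈ p)
  modularTriple⇔[p∨q]∧r≈p {p} {q} {r} p≤r q∧r≤p = mk⇔
    (λ (_ , modular) → Eq.trans modular p∨[q∧r]≈p)
    (λ [p∨q]∧r≈p → p≤r , Eq.trans [p∨q]∧r≈p (Eq.sym p∨[q∧r]≈p))
    where
    p∨[q∧r]≈p : p ∨ (q ∧ r) ≈ p
    p∨[q∧r]≈p = antisym (∨-least refl q∧r≤p) (x≤x∨y p (q ∧ r))

  modularTriple⇔p∨[q∧r]≈r : ∀ {p q r} → p ≤ r → r ≤ p ∨ q →
    ModularTriple L p q r ⇔ (p ∨ (q ∧ r) ≈ r)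
  modularTriple⇔p∨[q∧r]≈r {p} {q} {r} p≤r r≤p∨q = mk⇔
    (λ (_ , modular) → Eq.trans (Eq.sym modular) [p∨q]∧r≈r)
    (λ p∨[q∧r]≈r → p≤r , Eq.trans [p∨q]∧r≈r (Eq.sym p∨[q∧r]≈r))
    where
    [p∨q]∧r≈r : (p ∨ q) ∧ r ≈ r
    [p∨q]∧r≈r = antisym (x∧y≤y (p ∨ q) r) (∧-greatest r≤p∨q refl)

theorem3 : {c ℓ₁ ℓ₂ : Level} (L : BoundedLattice c ℓ₁ ℓ₂) →
    let open BoundedLattice L in
    (a b x y : Carrier) → a ≤ b → InInterval L a b x → IsComplement L x y →
    ModularTriple L a y b →
    (InR L a b x ((a ∨ y) ∧ b) ⇔ (ModularTriple L a (y ∧ b) x × ModularTriple L x (a ∨ y) b))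
theorem3 L a b x y a≤b (a≤x , x≤b) (x∨y≈⊤ , x∧y≈⊥) (_ , e≈a∨[y∧b]) = mk⇔
  (λ (_ , x∨e≈b , x∧e≈a) →
    from lower (Eq.trans (Eq.sym x∧e≈[a∨[y∧b]]∧x) x∧e≈a) , from upper x∨e≈b)
  (λ (lowerModular , upperModular) →
    (∧-greatest (x≤x∨y a y) a≤b , x∧y≤y (a ∨ y) b) ,
    to upper upperModular ,
    Eq.trans x∧e≈[a∨[y∧b]]∧x (to lower lowerModular))
  where
  open BoundedLattice L
  open MeetSemilatticeProperties meetSemilattice using (∧-comm; ∧-cong; ∧-monotonic)
  open Equivalence

  [y∧b]∧x≤a : (y ∧ b) ∧ x ≤ a
  [y∧b]∧x≤a = trans (∧-monotonic (x∧y≤x y b) refl)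
    (trans (reflexive (Eq.trans (∧-comm y x) x∧y≈⊥)) (minimum a))

  b≤x∨[a∨y] : b ≤ x ∨ (a ∨ y)
  b≤x∨[a∨y] = trans (maximum b)
    (trans (reflexive (Eq.sym x∨y≈⊤))
      (∨-least (x≤x∨y x (a ∨ y)) (trans (y≤x∨y a y) (y≤x∨y x (a ∨ y)))))

  lower : ModularTriple L a (y ∧ b) x ⇔ ((a ∨ (y ∧ b)) ∧ x ≈ a)
  lower = modularTriple⇔[p∨q]∧r≈p L a≤x [y∧b]∧x≤a

  upper : ModularTriple L x (a ∨ y) b ⇔ (x ∨ ((a ∨ y) ∧ b) ≈ b)
  upper = modularTriple⇔p∨[q∧r]≈r L x≤b b≤x∨[a∨y]

  x∧e≈[a∨[y∧b]]∧x : x ∧ ((a ∨ y) ∧ b) ≈ (a ∨ (y ∧ b)) ∧ x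
  x∧e≈[a∨[y∧b]]∧x = Eq.trans (∧-comm x _) (∧-cong e≈a∨[y∧b] Eq.refl)
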